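{- Let $D$ be an eulerian digraph in which all but exactly two vertices have degree congruent to $2$ mod $4$ (so the remaining two vertices $x,y$ have degree congruent to $0$ mod $4$), and let $T$ be a directed euler circuit of $D$ that interlaces $x$ and $y$. Then $D$ has a bi-eulerian directed embedding (necessarily orientable) with one of its faces bounded by $T$.
   Context: Digraphs are finite and may have loops and multiple arcs; the degree of a vertex is its total degree. A digraph is eulerian if it has a directed circuit using every arc and every vertex (a directed euler circuit). A circuit interlaces two vertices $x$ and $y$ if its cyclic vertex sequence can be written as $(\dots x \dots y \dots x \dots y \dots)$. Embeddings are cellular in closed surfaces; a directed embedding is one in which every face is bounded by a directed closed walk; a bi-eulerian directed embedding is one with exactly two faces, each bounded by a directed euler circuit. -}

module Defs where

open import Data.Nat using (ℕ; zero; suc; _+_; _<_; _%_)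
open import Data.Fin using (Fin)
open import Data.Fin.Properties using (_≟_)
open import Data.List using (List; length; filter; allFin)
open import Data.Sum using (_⊎_; inj₁; inj₂)
open import Data.Product using (Σ; ∃; ∃-syntax; _×_; _,_)
open import Relation.Nullary using (¬_)
open import Relation.Binary.PropositionalEquality using (_≡_; _≢_)

iter : {A : Set} → (A → A) → ℕ → A → A
iter f zero    x = x
iter f (suc k) x = f (iter f k x)

record Digraph : Set where
  field
    nV : ℕ
    nA : ℕ
    tl : Fin nA → Fin nV
    hd : Fin nA → Fin nV

module _ (D : Digraph) where
  open Digraph D

  -- total degree (in-degree + out-degree; a loop contributes 2)
  deg : Fin nV → ℕ
  deg v = length (filter (λ a → tl a ≟ v) (allFin nA))
        + length (filter (λ a → hd a ≟ v) (allFin nA))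

  -- A directed euler circuit, as a cyclic sequence of all arcs (starting
  -- point forgotten): nxt a is the arc traversed right after a.
  record EulerCircuit : Set where
    field
      nxt        : Fin nA → Fin nA
      consecutive : ∀ a → hd a ≡ tl (nxt a)
      single     : ∀ a b → ∃[ k ] (iter nxt k a ≡ b)
      allVertices : ∀ v → ∃[ a ] (tl a ≡ v)

  -- T interlaces x and y: the cyclic vertex sequence (heads of the arcs in
  -- order, read from some starting arc a0) is of the form ..x..y..x..y..
  Interlaces : EulerCircuit → Fin nV → Fin nV → Set
  Interlaces T x y =
    ∃[ a0 ] ∃[ i ] ∃[ j ] ∃[ k ] ∃[ l ]
      (i < j × j < k × k < l × l < nA ×
       vs a0 i ≡ x × vs a0 j ≡ y × vs a0 k ≡ x × vs a0 l ≡ y)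
    where
    vs : Fin nA → ℕ → Fin nV
    vs a0 t = hd (iter (EulerCircuit.nxt T) t a0)

  -- Darts (arc-ends): inj₁ a = tail end of a, inj₂ a = head end of a.
  Dart : Set
  Dart = Fin nA ⊎ Fin nA

  dvert : Dart → Fin nV
  dvert (inj₁ a) = tl a
  dvert (inj₂ a) = hd a

  flip : Dart → Dart
  flip (inj₁ a) = inj₂ a
  flip (inj₂ a) = inj₁ a

  -- Rotation systems are the
  -- standard combinatorial description of cellular embeddings of connected
  -- graphs in closed orientable surfaces (Heffter-Edmonds-Ringel).
  record RotationSystem : Set where
    field
      rot      : Dart → Dart
      rot⁻¹    : Dart → Dart
      rot-inv₁ : ∀ d → rot (rot⁻¹ d) ≡ d
      rot-inv₂ : ∀ d → rot⁻¹ (rot d) ≡ d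
      rot-vert : ∀ d → dvert (rot d) ≡ dvert d
      rot-cyc  : ∀ d e → dvert d ≡ dvert e → ∃[ k ] (iter rot k d ≡ e)

    -- Faces = orbits of φ; dart inj₁ a in a
    -- face walk means a is traversed forwards, inj₂ a backwards.
    φ : Dart → Dart
    φ d = rot (flip d)

    SameFace : Dart → Dart → Set
    SameFace d e = ∃[ k ] (iter φ k d ≡ e)

  module _ (R : RotationSystem) where
    open RotationSystem R

    IsFwd : Dart → Set
    IsFwd d = ∃[ a ] (d ≡ inj₁ a)

    IsBwd : Dart → Set
    IsBwd d = ∃[ a ] (d ≡ inj₂ a)

    FaceDirected : Dart → Set
    FaceDirected d = (∀ k → IsFwd (iter φ k d)) ⊎ (∀ k → IsBwd (iter φ k d))

    DirectedEmbedding : Set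
    DirectedEmbedding = ∀ d → FaceDirected d

    FaceEuler : Dart → Set
    FaceEuler d = ((∀ k → IsFwd (iter φ k d)) × (∀ a → SameFace d (inj₁ a)))
                ⊎ ((∀ k → IsBwd (iter φ k d)) × (∀ a → SameFace d (inj₂ a)))

    ExactlyTwoFaces : Set
    ExactlyTwoFaces = ∃[ d₁ ] ∃[ d₂ ]
      (¬ SameFace d₁ d₂ × (∀ e → SameFace d₁ e ⊎ SameFace d₂ e))

    BiEulerianDirected : Set
    BiEulerianDirected =
      DirectedEmbedding × ExactlyTwoFaces × (∀ d → FaceEuler d)

    HasFaceBoundedBy : EulerCircuit → Set
    HasFaceBoundedBy T =
        (∀ a → φ (inj₁ a) ≡ inj₁ (EulerCircuit.nxt T a))
      ⊎ (∀ a → φ (inj₂ (EulerCircuit.nxt T a)) ≡ inj₂ a)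

-- The rotation system that turns each in-dart a into the out-dart nxt a (nxt being the successor in T) and
-- each out-dart b into the in-dart ρ b has exactly the faces traced by nxt and by ρ. So it suffices to find
-- a cyclic permutation ρ of all arcs with hd (ρ b) ≡ tl b such that, at every vertex v, ρ ∘ nxt permutes the
-- in-arcs at v cyclically. Start from ρ = nxt⁻¹, for which ρ ∘ nxt is the identity, and multiply it by the
-- transposition of the two arcs by which T enters x at the interlaced visits and by the corresponding
-- transposition at y: because the visits interlace, ρ stays a single cycle, and ρ ∘ nxt becomes a 2-cycle at
-- x and at y. The remaining in-arcs are then inserted two at a time into the cycle at their vertex, each time
-- multiplying ρ by a 3-cycle whose orientation is chosen so that ρ stays a single cycle. This exhausts the
-- in-arcs at v exactly when their number is odd for v ≠ x, y and even for v = x, y, which is what the degree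
-- conditions say, as deg v = 2 · indeg v.
module Submission where

open import Defs
open import Data.Empty using (⊥-elim)
open import Data.Fin using (Fin; toℕ; fromℕ<)
open import Data.Fin.Properties using (_≟_; injective⇒≤; fromℕ<-injective; pigeonhole; toℕ<n)
open import Data.List
  using (List; []; _∷_; _++_; _∷ʳ_; [_]; length; filter; allFin; map; applyDownFrom; initLast; _∷ʳ′_)
open import Data.List.Membership.Propositional using (_∈_; _∉_)
open import Data.List.Membership.Propositional.Properties
  using (∈-++⁺ˡ; ∈-++⁺ʳ; ∈-++⁻; ∈-∃++; ∈-applyDownFrom⁺; ∈-filter⁺; ∈-filter⁻; ∈-allFin;
         ∈-map⁺; ∈-map⁻)
open import Data.List.Membership.Propositional.Properties.WithK using (unique∧set⇒bag)
open import Data.List.Properties using (++-assoc; ++-identityʳ; length-++; length-map; applyDownFrom-∷ʳ)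
open import Data.List.Relation.Binary.BagAndSetEquality using (∼bag⇒↭)
open import Data.List.Relation.Binary.Permutation.Propositional
  using (_↭_; ↭-refl; ↭-reflexive; ↭-sym; ↭-trans; ↭-prep; ↭-swap; ↭⇒↭ₛ)
open import Data.List.Relation.Binary.Permutation.Propositional.Properties
  using (∈-resp-↭; ↭-length; ++-comm; ++⁺ˡ; ++⁺ʳ; shift)
import Data.List.Relation.Binary.Permutation.Setoid.Properties as PermutationSetoid
open import Data.List.Relation.Unary.All as All using (All; []; _∷_)
import Data.List.Relation.Unary.All.Properties as Allₚ
open import Data.List.Relation.Unary.Any as Any using (here; there)
open import Data.List.Relation.Unary.Unique.Propositional using (Unique; []; _∷_)
open import Data.List.Relation.Unary.Unique.Propositional.Properties
  using (Unique[x∷xs]⇒x∉xs; applyDownFrom⁺₁; filter⁺; allFin⁺; map⁺)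
open import Data.Nat
  using (ℕ; zero; suc; pred; _+_; _*_; _≤_; _<_; _≤′_; ≤′-reflexive; ≤′-step; _%_; _/_; s≤s; s≤s⁻¹)
open import Data.Nat.DivMod using (m≡m%n+[m/n]*n; m%n<n)
open import Data.Nat.Properties
  using (+-comm; +-assoc; +-suc; +-identityʳ; ≤-refl; ≤-trans; ≤-antisym; <-trans; <⇒≤; <-irrefl;
         <-≤-trans; <-cmp; m≤n+m; n≤0⇒n≡0; +-cancelʳ-≤; ≤⇒≤′; m≤n⇒∃[o]m+o≡n)
open import Data.Product using (Σ; ∃-syntax; _×_; _,_; proj₁; proj₂)
open import Data.Sum using (inj₁; inj₂)
open import Function using (_∘_; id; mk⇔)
open import Relation.Binary.Definitions using (DecidableEquality; tri<; tri≈; tri>)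
open import Relation.Binary.PropositionalEquality
  using (_≡_; _≢_; refl; sym; trans; cong; cong₂; subst; subst₂; setoid; module ≡-Reasoning)
open import Relation.Nullary using (¬_; Dec; yes; no)

iter-+ : ∀ {A : Set} (f : A → A) m n x → iter f (m + n) x ≡ iter f m (iter f n x)
iter-+ f zero    n x = refl
iter-+ f (suc m) n x = cong f (iter-+ f m n x)

iter-suc : ∀ {A : Set} (f : A → A) k x → iter f (suc k) x ≡ iter f k (f x)
iter-suc f k x = trans (cong (λ t → iter f t x) (+-comm 1 k)) (iter-+ f k 1 x)

iter-twice : ∀ {A : Set} (f : A → A) m x → iter (f ∘ f) m x ≡ iter f (m + m) x
iter-twice f zero    x = refl
iter-twice f (suc m) x =
  trans (cong (f ∘ f) (iter-twice f m x)) (cong (λ k → iter f (suc k) x) (sym (+-suc m m)))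

iter-fixed : ∀ {A : Set} (f : A → A) {x} → f x ≡ x → ∀ k → iter f k x ≡ x
iter-fixed f fx≡x zero    = refl
iter-fixed f fx≡x (suc k) = trans (cong f (iter-fixed f fx≡x k)) fx≡x

iter-commute : ∀ {A B : Set} {f : A → A} {g : B → B} (h : A → B) →
               (∀ x → h (f x) ≡ g (h x)) → ∀ k x → h (iter f k x) ≡ iter g k (h x)
iter-commute         h hf≡gh zero    x = refl
iter-commute {g = g} h hf≡gh (suc k) x = trans (hf≡gh _) (cong g (iter-commute h hf≡gh k x))

iter-cong : ∀ {A : Set} {f g : A → A} → (∀ x → f x ≡ g x) → ∀ k x → iter f k x ≡ iter g k x
iter-cong = iter-commute id

iter-preserves : ∀ {A : Set} (P : A → Set) {f : A → A} → (∀ {x} → P x → P (f x)) →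
                 ∀ k {x} → P x → P (iter f k x)
iter-preserves P f-pres zero    Px = Px
iter-preserves P f-pres (suc k) Px = f-pres (iter-preserves P f-pres k Px)

iter-cong-on : ∀ {A : Set} (P : A → Set) {f g : A → A} → (∀ {x} → P x → P (f x)) →
               (∀ {x} → P x → f x ≡ g x) → ∀ k {x} → P x → iter f k x ≡ iter g k x
iter-cong-on P         f-pres f≡g zero    Px = refl
iter-cong-on P {g = g} f-pres f≡g (suc k) Px =
  trans (f≡g (iter-preserves P f-pres k Px)) (cong g (iter-cong-on P f-pres f≡g k Px))

periodic⇒inverse : ∀ {A : Set} (f : A → A) m → (∀ x → iter f (suc m) x ≡ x) →
                   (∀ x → f (iter f m x) ≡ x) × (∀ x → iter f m (f x) ≡ x)
periodic⇒inverse f m period = period , λ x → trans (sym (iter-suc f m x)) (period x)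

∉⇒≢ : ∀ {A : Set} {c d : A} {xs} → c ∉ xs → d ∈ xs → c ≢ d
∉⇒≢ c∉xs d∈xs refl = c∉xs d∈xs

∈⇒↭∷ : ∀ {A : Set} {u : A} {xs} → u ∈ xs → ∃[ ys ] xs ↭ u ∷ ys
∈⇒↭∷ u∈xs with ∈-∃++ u∈xs
... | P , Q , refl = P ++ Q , shift _ P Q

∈⇒↭∷∷ : ∀ {A : Set} {u w : A} {xs} → u ∈ xs → w ∈ xs → u ≢ w → ∃[ ys ] xs ↭ u ∷ w ∷ ys
∈⇒↭∷∷ u∈xs w∈xs u≢w with ∈⇒↭∷ u∈xs
... | ys , xs↭u∷ys with ∈⇒↭∷ (Any.tail (u≢w ∘ sym) (∈-resp-↭ xs↭u∷ys w∈xs))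
...   | zs , ys↭w∷zs = zs , ↭-trans xs↭u∷ys (↭-prep _ ys↭w∷zs)

Unique-++⁻ˡ : ∀ {A : Set} (xs : List A) {ys} → Unique (xs ++ ys) → Unique xs
Unique-++⁻ˡ []       _        = []
Unique-++⁻ˡ (x ∷ xs) (x∉ ∷ U) = Allₚ.++⁻ˡ xs x∉ ∷ Unique-++⁻ˡ xs U

Unique-++⁻ʳ : ∀ {A : Set} (xs : List A) {ys} → Unique (xs ++ ys) → Unique ys
Unique-++⁻ʳ []       U       = U
Unique-++⁻ʳ (x ∷ xs) (_ ∷ U) = Unique-++⁻ʳ xs U

Unique-++-disjoint : ∀ {A : Set} (xs : List A) {ys z} → Unique (xs ++ ys) → z ∈ xs → z ∉ ys
Unique-++-disjoint (x ∷ xs) U       (here refl)  z∈ys = Unique[x∷xs]⇒x∉xs U (∈-++⁺ʳ xs z∈ys)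
Unique-++-disjoint (x ∷ xs) (_ ∷ U) (there z∈xs) z∈ys = Unique-++-disjoint xs U z∈xs z∈ys

Unique-resp-↭ : ∀ {A : Set} {xs ys : List A} → xs ↭ ys → Unique xs → Unique ys
Unique-resp-↭ {A} xs↭ys = PermutationSetoid.Unique-resp-↭ (setoid A) (↭⇒↭ₛ xs↭ys)

fixes-tails : ∀ {A : Set} (g : A → A) hs {ts} → Unique (hs ++ ts) → (∀ {z} → z ∉ hs → g z ≡ z) →
              All (λ c → g c ≡ c) ts
fixes-tails g hs U g-fixes =
  All.tabulate (λ c∈ts → g-fixes (λ c∈hs → Unique-++-disjoint hs U c∈hs c∈ts))

pull-past : ∀ {A : Set} (xs ys : List A) v zs → xs ++ ys ++ v ∷ zs ↭ v ∷ xs ++ ys ++ zs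
pull-past xs ys v zs = ↭-trans (++⁺ˡ xs (shift v ys zs)) (shift v xs (ys ++ zs))

applyDownFrom-suffix : ∀ {B : Set} (f : ℕ → B) {m k} → m ≤′ k →
                       ∃[ W ] applyDownFrom f k ≡ W ++ applyDownFrom f m
applyDownFrom-suffix f (≤′-reflexive refl) = [] , refl
applyDownFrom-suffix f (≤′-step {k} m≤′k) =
  let W , eq = applyDownFrom-suffix f m≤′k in f k ∷ W , cong (f k ∷_) eq

Fin⇒suc-pred : ∀ {n} → Fin n → suc (pred n) ≡ n
Fin⇒suc-pred {suc _} _ = refl

[2+r+2+r]%4≡[r+r]%4 : ∀ r → (suc (suc r) + suc (suc r)) % 4 ≡ (r + r) % 4
[2+r+2+r]%4≡[r+r]%4 r = cong (λ n → suc (suc n) % 4) (trans (+-suc r (suc r)) (cong suc (+-suc r r)))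

[1+r+1+r]%4≡2⇒r%2≡0 : ∀ r → (suc r + suc r) % 4 ≡ 2 → r % 2 ≡ 0
[1+r+1+r]%4≡2⇒r%2≡0 zero          _  = refl
[1+r+1+r]%4≡2⇒r%2≡0 (suc zero)    ()
[1+r+1+r]%4≡2⇒r%2≡0 (suc (suc r)) eq =
  [1+r+1+r]%4≡2⇒r%2≡0 r (trans (sym ([2+r+2+r]%4≡[r+r]%4 (suc r))) eq)

[2+r+2+r]%4≢2⇒r%2≡0 : ∀ r → (suc (suc r) + suc (suc r)) % 4 ≢ 2 → r % 2 ≡ 0
[2+r+2+r]%4≢2⇒r%2≡0 zero          _   = refl
[2+r+2+r]%4≢2⇒r%2≡0 (suc zero)    neq = ⊥-elim (neq refl)
[2+r+2+r]%4≢2⇒r%2≡0 (suc (suc r)) neq =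
  [2+r+2+r]%4≢2⇒r%2≡0 r (neq ∘ trans ([2+r+2+r]%4≡[r+r]%4 (suc (suc r))))

module CyclicOrder {A : Set} (_≟_ : DecidableEquality A) where

  open import Data.List.Membership.DecPropositional _≟_ using (_∈?_)

  swap : A → A → A → A
  swap u w z with z ≟ u
  ... | yes _ = w
  ... | no _ with z ≟ w
  ...   | yes _ = u
  ...   | no _  = z

  swap-ˡ : ∀ u w → swap u w u ≡ w
  swap-ˡ u w with u ≟ u
  ... | yes _   = refl
  ... | no u≢u = ⊥-elim (u≢u refl)

  swap-ʳ : ∀ u w → swap u w w ≡ u
  swap-ʳ u w with w ≟ u
  ... | yes w≡u = w≡u
  ... | no _ with w ≟ w
  ...   | yes _   = refl
  ...   | no w≢w = ⊥-elim (w≢w refl)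

  swap-≢ : ∀ {u w z} → z ≢ u → z ≢ w → swap u w z ≡ z
  swap-≢ {u} {w} {z} z≢u z≢w with z ≟ u
  ... | yes z≡u = ⊥-elim (z≢u z≡u)
  ... | no _ with z ≟ w
  ...   | yes z≡w = ⊥-elim (z≢w z≡w)
  ...   | no _    = refl

  swap-preserves : ∀ (P : A → Set) {u w z} → P u → P w → P z → P (swap u w z)
  swap-preserves P {u} {w} {z} Pu Pw Pz with z ≟ u
  ... | yes _ = Pw
  ... | no _ with z ≟ w
  ...   | yes _ = Pu
  ...   | no _  = Pz

  cycle3 : A → A → A → A → A
  cycle3 a p q z = swap a p (swap p q z)

  cycle3-fixes : ∀ {a p q z} → z ∉ a ∷ p ∷ q ∷ [] → cycle3 a p q z ≡ z
  cycle3-fixes z∉ = trans (cong (swap _ _) (swap-≢ (z∉ ∘ there ∘ here) (z∉ ∘ there ∘ there ∘ here)))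
                          (swap-≢ (z∉ ∘ here) (z∉ ∘ there ∘ here))

  cycle3-moves : ∀ {a p q ts} → Unique (a ∷ p ∷ q ∷ ts) →
                 cycle3 a p q a ≡ p × cycle3 a p q p ≡ q × cycle3 a p q q ≡ a
  cycle3-moves ((a≢p ∷ a≢q ∷ _) ∷ (p≢q ∷ _) ∷ _) =
    trans (cong (swap _ _) (swap-≢ a≢p a≢q)) (swap-ˡ _ _) ,
    trans (cong (swap _ _) (swap-ˡ _ _)) (swap-≢ (a≢q ∘ sym) (p≢q ∘ sym)) ,
    trans (cong (swap _ _) (swap-ʳ _ _)) (swap-ʳ _ _)

  diagonalSwap : A → A → A → A → A → A
  diagonalSwap a b c d z = swap a c (swap b d z)

  diagonalSwap-fixes : ∀ {a b c d z} → z ∉ a ∷ b ∷ c ∷ d ∷ [] → diagonalSwap a b c d z ≡ z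
  diagonalSwap-fixes z∉ =
    trans (cong (swap _ _) (swap-≢ (z∉ ∘ there ∘ here) (z∉ ∘ there ∘ there ∘ there ∘ here)))
          (swap-≢ (z∉ ∘ here) (z∉ ∘ there ∘ there ∘ here))

  diagonalSwap-moves : ∀ {a b c d ts} → Unique (a ∷ b ∷ c ∷ d ∷ ts) →
    diagonalSwap a b c d a ≡ c × diagonalSwap a b c d b ≡ d ×
    diagonalSwap a b c d c ≡ a × diagonalSwap a b c d d ≡ b
  diagonalSwap-moves ((a≢b ∷ a≢c ∷ a≢d ∷ _) ∷ (b≢c ∷ b≢d ∷ _) ∷ (c≢d ∷ _) ∷ _) =
    trans (cong (swap _ _) (swap-≢ a≢b a≢d)) (swap-ˡ _ _) ,
    trans (cong (swap _ _) (swap-ˡ _ _)) (swap-≢ (a≢d ∘ sym) (c≢d ∘ sym)) ,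
    trans (cong (swap _ _) (swap-≢ (b≢c ∘ sym) c≢d)) (swap-ʳ _ _) ,
    trans (cong (swap _ _) (swap-ʳ _ _)) (swap-≢ (a≢b ∘ sym) b≢c)

  headOr : A → List A → A
  headOr h []      = h
  headOr h (x ∷ _) = x

  headOr-++ : ∀ xs ys h → headOr h (xs ++ ys) ≡ headOr (headOr h ys) xs
  headOr-++ []      ys h = refl
  headOr-++ (_ ∷ _) ys h = refl

  -- the successor of z in xs, continuing with h after the last element (and z itself when z ∉ xs)
  next : A → List A → A → A
  next h []       z = z
  next h (x ∷ xs) z with x ≟ z
  ... | yes _ = headOr h xs
  ... | no _  = next h xs z

  next-here : ∀ z ys {h} → next h (z ∷ ys) z ≡ headOr h ys
  next-here z ys with z ≟ z
  ... | yes _   = refl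
  ... | no z≢z = ⊥-elim (z≢z refl)

  next-∉ : ∀ xs {h z} → z ∉ xs → next h xs z ≡ z
  next-∉ []       z∉ = refl
  next-∉ (x ∷ xs) {z = z} z∉ with x ≟ z
  ... | yes refl = ⊥-elim (z∉ (here refl))
  ... | no _     = next-∉ xs (z∉ ∘ there)

  next-++ˡ : ∀ xs {ys h z} → z ∈ xs → next h (xs ++ ys) z ≡ next (headOr h ys) xs z
  next-++ˡ (x ∷ xs) {ys} {h} {z} z∈ with x ≟ z
  ... | yes _   = headOr-++ xs ys h
  ... | no x≢z = next-++ˡ xs (Any.tail (x≢z ∘ sym) z∈)

  next-++ʳ : ∀ xs {ys h z} → z ∉ xs → next h (xs ++ ys) z ≡ next h ys z
  next-++ʳ []       z∉ = refl
  next-++ʳ (x ∷ xs) {z = z} z∉ with x ≟ z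
  ... | yes refl = ⊥-elim (z∉ (here refl))
  ... | no _     = next-++ʳ xs (z∉ ∘ there)

  next-preserves : ∀ (P : A → Set) xs {h z} → All P xs → P h → P z → P (next h xs z)
  next-preserves P []       _                 _  Pz = Pz
  next-preserves P (x ∷ xs) {z = z} (_ ∷ Pxs) Ph Pz with x ≟ z | Pxs
  ... | yes _ | []     = Ph
  ... | yes _ | Py ∷ _ = Py
  ... | no _  | _      = next-preserves P xs Pxs Ph Pz

  next-relabel : ∀ (g : A → A) x xs {h h′ z} → All (λ c → g c ≡ c) xs → g h ≡ h′ →
                 z ∈ x ∷ xs → g (next h (x ∷ xs) z) ≡ next h′ (x ∷ xs) z
  next-relabel g x [] fix gh≡h′ (here refl) =
    trans (cong g (next-here x [])) (trans gh≡h′ (sym (next-here x [])))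
  next-relabel g x (y ∷ ys) {z = z} (gy≡y ∷ fix) gh≡h′ z∈ with x ≟ z
  ... | yes _   = gy≡y
  ... | no x≢z = next-relabel g y ys fix gh≡h′ (Any.tail (x≢z ∘ sym) z∈)

  -- the cyclic permutation (x₀ x₁ … xₙ) for xs = x₀ ∷ x₁ ∷ … ∷ xₙ ∷ []
  cyc : List A → A → A
  cyc xs z = next (headOr z xs) xs z

  cyc-∉ : ∀ {xs z} → z ∉ xs → cyc xs z ≡ z
  cyc-∉ {xs} = next-∉ xs

  cyc-preserves : ∀ (P : A → Set) {xs z} → All P xs → P z → P (cyc xs z)
  cyc-preserves P {[]}     _                Pz = Pz
  cyc-preserves P {x ∷ xs} Pxxs@(Px ∷ _) Pz = next-preserves P (x ∷ xs) Pxxs Px Pz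

  cyc-singleton : ∀ a z → cyc (a ∷ []) z ≡ z
  cyc-singleton a z with a ≟ z
  ... | yes a≡z = a≡z
  ... | no _    = refl

  cyc-pair : ∀ {u w} → u ≢ w → ∀ z → cyc (u ∷ w ∷ []) z ≡ swap u w z
  cyc-pair {u} {w} u≢w z with z ∈? u ∷ w ∷ []
  ... | yes (here refl)         = trans (next-here u (w ∷ [])) (sym (swap-ˡ u w))
  ... | yes (there (here refl)) = trans (next-++ʳ (u ∷ []) λ { (here w≡u) → u≢w (sym w≡u) })
                                        (trans (next-here w []) (sym (swap-ʳ u w)))
  ... | no z∉                   = trans (cyc-∉ z∉) (sym (swap-≢ (z∉ ∘ here) (z∉ ∘ there ∘ here)))

  cyc-rotate : ∀ xs ys → Unique (xs ++ ys) → ∀ z → cyc (xs ++ ys) z ≡ cyc (ys ++ xs) z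
  cyc-rotate []       ys       _ z = cong (λ l → cyc l z) (sym (++-identityʳ ys))
  cyc-rotate (x ∷ xs) []       _ z = cong (λ l → cyc l z) (++-identityʳ (x ∷ xs))
  cyc-rotate (x ∷ xs) (y ∷ ys) U z with z ∈? x ∷ xs | z ∈? y ∷ ys
  ... | yes z∈X | _       =
    trans (next-++ˡ (x ∷ xs) z∈X) (sym (next-++ʳ (y ∷ ys) (Unique-++-disjoint (x ∷ xs) U z∈X)))
  ... | no z∉X  | yes z∈Y = trans (next-++ʳ (x ∷ xs) z∉X) (sym (next-++ˡ (y ∷ ys) z∈Y))
  ... | no z∉X  | no z∉Y  = trans (next-++ʳ (x ∷ xs) z∉X)
    (trans (next-∉ (y ∷ ys) z∉Y) (sym (trans (next-++ʳ (y ∷ ys) z∉Y) (next-∉ (x ∷ xs) z∉X))))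

  cyc-next : ∀ us {u w vs} → Unique (us ++ u ∷ w ∷ vs) → cyc (us ++ u ∷ w ∷ vs) u ≡ w
  cyc-next us {u} {w} U = trans (next-++ʳ us (λ u∈us → Unique-++-disjoint us U u∈us (here refl)))
                                (next-here u (w ∷ _))

  cyc-last : ∀ xs {z} → Unique (xs ∷ʳ z) → cyc (xs ∷ʳ z) z ≡ headOr z xs
  cyc-last xs {z} U = trans (next-++ʳ xs (λ z∈xs → Unique-++-disjoint xs U z∈xs (here refl)))
                            (trans (next-here z []) (headOr-++ xs [ z ] z))

  cyc-iterate : ∀ us ps {x z vs L} → Unique L → L ≡ us ++ x ∷ ps ++ z ∷ vs →
                iter (cyc L) (suc (length ps)) x ≡ z
  cyc-iterate us []       U refl = cyc-next us U
  cyc-iterate us (p ∷ ps) {x} {z} {vs} {L} U refl = begin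
    iter (cyc L) (suc (suc (length ps))) x   ≡⟨ iter-suc (cyc L) (suc (length ps)) x ⟩
    iter (cyc L) (suc (length ps)) (cyc L x) ≡⟨ cong (iter (cyc L) (suc (length ps))) (cyc-next us U) ⟩
    iter (cyc L) (suc (length ps)) p         ≡⟨ cyc-iterate (us ∷ʳ x) ps U (sym (++-assoc us [ x ] _)) ⟩
    z                                        ∎
    where open ≡-Reasoning

  cyc-connected : ∀ {xs x z} → Unique xs → x ∈ xs → z ∈ xs → ∃[ k ] iter (cyc xs) k x ≡ z
  cyc-connected U x∈ z∈ with ∈-∃++ x∈
  ... | us , vs , refl with ∈-++⁻ us z∈
  ...   | inj₂ (here refl) = 0 , refl
  ...   | inj₂ (there z∈vs) with ∈-∃++ z∈vs
  ...     | ps , qs , refl = suc (length ps) , cyc-iterate us ps U refl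
  cyc-connected {x = x} {z} U x∈ z∈ | us , vs , refl | inj₁ z∈us with ∈-∃++ z∈us
  ...     | ps , qs , refl = k , (begin
    iter (cyc (us ++ x ∷ vs)) k x ≡⟨ iter-cong (cyc-rotate us (x ∷ vs) U) k x ⟩
    iter (cyc (x ∷ vs ++ us)) k x ≡⟨ cyc-iterate [] (vs ++ ps) (Unique-resp-↭ (++-comm us (x ∷ vs)) U)
                                                  (cong (x ∷_) (sym (++-assoc vs ps (z ∷ qs)))) ⟩
    z                             ∎)
    where
    open ≡-Reasoning
    k : ℕ
    k = suc (length (vs ++ ps))

  cyc-returns : ∀ z ws → Unique (z ∷ ws) → iter (cyc (z ∷ ws)) (suc (length ws)) z ≡ z
  cyc-returns z ws U with initLast ws
  ... | []        = cyc-singleton z z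
  ... | ps ∷ʳ′ w = begin
    cyc L (iter (cyc L) (length (ps ∷ʳ w)) z) ≡⟨ cong (λ n → cyc L (iter (cyc L) n z)) length-L ⟩
    cyc L (iter (cyc L) (suc (length ps)) z)  ≡⟨ cong (cyc L) (cyc-iterate [] ps U refl) ⟩
    cyc L w                                   ≡⟨ cyc-last (z ∷ ps) U ⟩
    z                                         ∎
    where
    open ≡-Reasoning
    L : List A
    L = z ∷ ps ∷ʳ w
    length-L : length (ps ∷ʳ w) ≡ suc (length ps)
    length-L = trans (length-++ ps) (+-comm (length ps) 1)

  cyc-period : ∀ {xs} → Unique xs → ∀ z → iter (cyc xs) (length xs) z ≡ z
  cyc-period {xs} U z with z ∈? xs
  ... | no z∉ = iter-fixed (cyc xs) (cyc-∉ z∉) (length xs)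
  ... | yes z∈ with ∈-∃++ z∈
  ...   | us , vs , refl = begin
    iter (cyc (us ++ z ∷ vs)) (length (us ++ z ∷ vs)) z
      ≡⟨ iter-cong (cyc-rotate us (z ∷ vs) U) (length (us ++ z ∷ vs)) z ⟩
    iter (cyc (z ∷ vs ++ us)) (length (us ++ z ∷ vs)) z
      ≡⟨ cong (λ n → iter (cyc (z ∷ vs ++ us)) n z) (↭-length rotation) ⟩
    iter (cyc (z ∷ vs ++ us)) (suc (length (vs ++ us))) z
      ≡⟨ cyc-returns z (vs ++ us) (Unique-resp-↭ rotation U) ⟩
    z ∎
    where
    open ≡-Reasoning
    rotation : us ++ z ∷ vs ↭ z ∷ vs ++ us
    rotation = ++-comm us (z ∷ vs)

  cyc-inverse : ∀ {xs} → Unique xs →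
                Σ (A → A) λ g → (∀ z → cyc xs (g z) ≡ z) × (∀ z → g (cyc xs z) ≡ z)
  cyc-inverse {[]}     _ = id , (λ _ → refl) , (λ _ → refl)
  cyc-inverse {x ∷ xs} U =
    iter (cyc (x ∷ xs)) (length xs) , periodic⇒inverse (cyc (x ∷ xs)) (length xs) (cyc-period U)

  cyc-block : ∀ P {b bs S L z} → Unique L → L ≡ P ++ (b ∷ bs) ++ S → z ∈ b ∷ bs →
              cyc L z ≡ next (headOr (headOr b P) S) (b ∷ bs) z
  cyc-block P {b} {bs} {S} {z = z} U refl z∈B = begin
    next (headOr z (P ++ (b ∷ bs) ++ S)) (P ++ (b ∷ bs) ++ S) z
      ≡⟨ cong (λ h → next h (P ++ (b ∷ bs) ++ S) z) (head P) ⟩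
    next (headOr b P) (P ++ (b ∷ bs) ++ S) z
      ≡⟨ next-++ʳ P z∉P ⟩
    next (headOr b P) ((b ∷ bs) ++ S) z
      ≡⟨ next-++ˡ (b ∷ bs) z∈B ⟩
    next (headOr (headOr b P) S) (b ∷ bs) z ∎
    where
    open ≡-Reasoning
    head : ∀ P → headOr z (P ++ (b ∷ bs) ++ S) ≡ headOr b P
    head []      = refl
    head (_ ∷ _) = refl
    z∉P : z ∉ P
    z∉P z∈P = Unique-++-disjoint P U z∈P (∈-++⁺ˡ z∈B)

  cyc-block-last : ∀ P {b bs L z} → Unique L → L ≡ P ++ b ∷ bs → z ∈ b ∷ bs →
                   cyc L z ≡ next (headOr b P) (b ∷ bs) z
  cyc-block-last P U refl = cyc-block P U (cong (P ++_) (sym (++-identityʳ _)))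

  relabel-block : ∀ (g : A → A) {L L′ b bs h h′ z} → All (λ c → g c ≡ c) bs → g h ≡ h′ →
                  z ∈ b ∷ bs → cyc L z ≡ next h (b ∷ bs) z → cyc L′ z ≡ next h′ (b ∷ bs) z →
                  cyc L′ z ≡ g (cyc L z)
  relabel-block g fix gh≡h′ z∈ in-L in-L′ =
    trans in-L′ (sym (trans (cong g in-L) (next-relabel g _ _ fix gh≡h′ z∈)))

  cyc-exchange : ∀ a as p ps q qs → Unique ((a ∷ as) ++ (p ∷ ps) ++ (q ∷ qs)) → ∀ z →
    cyc ((a ∷ as) ++ (q ∷ qs) ++ (p ∷ ps)) z ≡ cycle3 a p q (cyc ((a ∷ as) ++ (p ∷ ps) ++ (q ∷ qs)) z)
  cyc-exchange a as p ps q qs U z = by-position (cycle3-moves U-heads-first) (z ∈? X ++ Y ++ Z)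
    where
    X Y Z : List A
    X = a ∷ as
    Y = p ∷ ps
    Z = q ∷ qs
    g : A → A
    g = cycle3 a p q
    L′↭L : X ++ Z ++ Y ↭ X ++ Y ++ Z
    L′↭L = ++⁺ˡ X (++-comm Z Y)
    U′ : Unique (X ++ Z ++ Y)
    U′ = Unique-resp-↭ (↭-sym L′↭L) U
    heads-first : X ++ Y ++ Z ↭ (a ∷ p ∷ q ∷ []) ++ as ++ ps ++ qs
    heads-first = ↭-prep a (↭-trans (shift p as (ps ++ Z)) (↭-prep p (pull-past as ps q qs)))
    U-heads-first : Unique ((a ∷ p ∷ q ∷ []) ++ as ++ ps ++ qs)
    U-heads-first = Unique-resp-↭ heads-first U
    heads⊆L : z ∈ a ∷ p ∷ q ∷ [] → z ∈ X ++ Y ++ Z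
    heads⊆L = ∈-resp-↭ (↭-sym heads-first) ∘ ∈-++⁺ˡ
    fix : All (λ c → g c ≡ c) (as ++ ps ++ qs)
    fix = fixes-tails g (a ∷ p ∷ q ∷ []) U-heads-first cycle3-fixes
    fix-pqs : All (λ c → g c ≡ c) (ps ++ qs)
    fix-pqs = Allₚ.++⁻ʳ as fix

    by-position : g a ≡ p × g p ≡ q × g q ≡ a → Dec (z ∈ X ++ Y ++ Z) →
                  cyc (X ++ Z ++ Y) z ≡ g (cyc (X ++ Y ++ Z) z)
    by-position _ (no z∉L) =
      trans (cyc-∉ (z∉L ∘ ∈-resp-↭ L′↭L))
            (sym (trans (cong g (cyc-∉ z∉L)) (cycle3-fixes (z∉L ∘ heads⊆L))))
    by-position (g-a , g-p , g-q) (yes z∈L) with ∈-++⁻ X z∈L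
    ... | inj₁ z∈X = relabel-block g (Allₚ.++⁻ˡ as fix) g-p z∈X
                       (cyc-block [] U refl z∈X) (cyc-block [] U′ refl z∈X)
    ... | inj₂ z∈YZ with ∈-++⁻ Y z∈YZ
    ...   | inj₁ z∈Y = relabel-block g (Allₚ.++⁻ˡ ps fix-pqs) g-q z∈Y
                         (cyc-block X U refl z∈Y) (cyc-block-last (X ++ Z) U′ (sym (++-assoc X Z Y)) z∈Y)
    ...   | inj₂ z∈Z = relabel-block g (Allₚ.++⁻ʳ ps fix-pqs) g-a z∈Z
                         (cyc-block-last (X ++ Y) U (sym (++-assoc X Y Z)) z∈Z) (cyc-block X U′ refl z∈Z)

  reverse-blocks-↭ : ∀ (xs ys zs ws : List A) → xs ++ ws ++ zs ++ ys ↭ xs ++ ys ++ zs ++ ws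
  reverse-blocks-↭ xs ys zs ws = ++⁺ˡ xs (↭-trans (++-comm ws (zs ++ ys))
                                   (↭-trans (++⁺ʳ ws (++-comm zs ys)) (↭-reflexive (++-assoc ys zs ws))))

  cyc-reverse-blocks : ∀ a as b bs c cs d ds → Unique ((a ∷ as) ++ (b ∷ bs) ++ (c ∷ cs) ++ (d ∷ ds)) →
    ∀ z → cyc ((a ∷ as) ++ (d ∷ ds) ++ (c ∷ cs) ++ (b ∷ bs)) z
            ≡ diagonalSwap a b c d (cyc ((a ∷ as) ++ (b ∷ bs) ++ (c ∷ cs) ++ (d ∷ ds)) z)
  cyc-reverse-blocks a as b bs c cs d ds U z =
    by-position (diagonalSwap-moves U-heads-first) (z ∈? X₁ ++ X₂ ++ X₃ ++ X₄)
    where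
    X₁ X₂ X₃ X₄ : List A
    X₁ = a ∷ as
    X₂ = b ∷ bs
    X₃ = c ∷ cs
    X₄ = d ∷ ds
    g : A → A
    g = diagonalSwap a b c d
    L′↭L : X₁ ++ X₄ ++ X₃ ++ X₂ ↭ X₁ ++ X₂ ++ X₃ ++ X₄
    L′↭L = reverse-blocks-↭ X₁ X₂ X₃ X₄
    U′ : Unique (X₁ ++ X₄ ++ X₃ ++ X₂)
    U′ = Unique-resp-↭ (↭-sym L′↭L) U
    heads-first : X₁ ++ X₂ ++ X₃ ++ X₄ ↭ (a ∷ b ∷ c ∷ d ∷ []) ++ as ++ bs ++ cs ++ ds
    heads-first = ↭-prep a (↭-trans (shift b as (bs ++ X₃ ++ X₄))
                    (↭-prep b (↭-trans (pull-past as bs c (cs ++ X₄))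
                      (↭-prep c (↭-trans (++⁺ˡ as (pull-past bs cs d ds)) (shift d as (bs ++ cs ++ ds)))))))
    U-heads-first : Unique ((a ∷ b ∷ c ∷ d ∷ []) ++ as ++ bs ++ cs ++ ds)
    U-heads-first = Unique-resp-↭ heads-first U
    heads⊆L : z ∈ a ∷ b ∷ c ∷ d ∷ [] → z ∈ X₁ ++ X₂ ++ X₃ ++ X₄
    heads⊆L = ∈-resp-↭ (↭-sym heads-first) ∘ ∈-++⁺ˡ
    fix : All (λ e → g e ≡ e) (as ++ bs ++ cs ++ ds)
    fix = fixes-tails g (a ∷ b ∷ c ∷ d ∷ []) U-heads-first diagonalSwap-fixes
    fix-bcds : All (λ e → g e ≡ e) (bs ++ cs ++ ds)
    fix-bcds = Allₚ.++⁻ʳ as fix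
    fix-cds : All (λ e → g e ≡ e) (cs ++ ds)
    fix-cds = Allₚ.++⁻ʳ bs fix-bcds
    last-block : ∀ xs ys zs ws → xs ++ ys ++ zs ++ ws ≡ (xs ++ ys ++ zs) ++ ws
    last-block xs ys zs ws = sym (trans (++-assoc xs (ys ++ zs) ws) (cong (xs ++_) (++-assoc ys zs ws)))

    by-position : g a ≡ c × g b ≡ d × g c ≡ a × g d ≡ b → Dec (z ∈ X₁ ++ X₂ ++ X₃ ++ X₄) →
                  cyc (X₁ ++ X₄ ++ X₃ ++ X₂) z ≡ g (cyc (X₁ ++ X₂ ++ X₃ ++ X₄) z)
    by-position _ (no z∉L) =
      trans (cyc-∉ (z∉L ∘ ∈-resp-↭ L′↭L))
            (sym (trans (cong g (cyc-∉ z∉L)) (diagonalSwap-fixes (z∉L ∘ heads⊆L))))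
    by-position (g-a , g-b , g-c , g-d) (yes z∈L) with ∈-++⁻ X₁ z∈L
    ... | inj₁ z∈X₁ = relabel-block g (Allₚ.++⁻ˡ as fix) g-b z∈X₁
                        (cyc-block [] U refl z∈X₁) (cyc-block [] U′ refl z∈X₁)
    ... | inj₂ z∈X₂₃₄ with ∈-++⁻ X₂ z∈X₂₃₄
    ...   | inj₁ z∈X₂ = relabel-block g (Allₚ.++⁻ˡ bs fix-bcds) g-c z∈X₂
                          (cyc-block X₁ U refl z∈X₂)
                          (cyc-block-last (X₁ ++ X₄ ++ X₃) U′ (last-block X₁ X₄ X₃ X₂) z∈X₂)
    ...   | inj₂ z∈X₃₄ with ∈-++⁻ X₃ z∈X₃₄
    ...     | inj₁ z∈X₃ = relabel-block g (Allₚ.++⁻ˡ cs fix-cds) g-d z∈X₃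
                            (cyc-block (X₁ ++ X₂) U (sym (++-assoc X₁ X₂ _)) z∈X₃)
                            (cyc-block (X₁ ++ X₄) U′ (sym (++-assoc X₁ X₄ _)) z∈X₃)
    ...     | inj₂ z∈X₄ = relabel-block g (Allₚ.++⁻ʳ cs fix-cds) g-a z∈X₄
                            (cyc-block-last (X₁ ++ X₂ ++ X₃) U (last-block X₁ X₂ X₃ X₄) z∈X₄)
                            (cyc-block X₁ U′ refl z∈X₄)

  cyc-interlaced : ∀ W a as b bs c cs d ds → let L = W ++ (a ∷ as) ++ (b ∷ bs) ++ (c ∷ cs) ++ (d ∷ ds) in
    Unique L → ∃[ L′ ] (L′ ↭ L × ∀ z → cyc L′ z ≡ diagonalSwap a b c d (cyc L z))
  cyc-interlaced W a as b bs c cs d ds U =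
    X₁ ++ X₄′ ++ X₃ ++ X₂ ,
    ↭-trans (reverse-blocks-↭ X₁ X₂ X₃ X₄′) (↭-trans (↭-reflexive (sym rotated)) (++-comm B W)) ,
    λ z → trans (cyc-reverse-blocks a as b bs c cs d (ds ++ W) U-rotated z)
                (cong (diagonalSwap a b c d) (sym (trans (cyc-rotate W B U z) (cong (λ l → cyc l z) rotated))))
    where
    X₁ X₂ X₃ X₄ X₄′ B : List A
    X₁ = a ∷ as
    X₂ = b ∷ bs
    X₃ = c ∷ cs
    X₄ = d ∷ ds
    X₄′ = d ∷ ds ++ W
    B = X₁ ++ X₂ ++ X₃ ++ X₄
    rotated : B ++ W ≡ X₁ ++ X₂ ++ X₃ ++ X₄′
    rotated = trans (++-assoc X₁ (X₂ ++ X₃ ++ X₄) W)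
                    (cong (X₁ ++_) (trans (++-assoc X₂ (X₃ ++ X₄) W) (cong (X₂ ++_) (++-assoc X₃ X₄ W))))
    U-rotated : Unique (X₁ ++ X₂ ++ X₃ ++ X₄′)
    U-rotated = subst Unique rotated (Unique-resp-↭ (++-comm W B) U)

  cyc-append : ∀ a as p q → Unique ((a ∷ as) ++ p ∷ q ∷ []) → ∀ z →
               cyc ((a ∷ as) ++ p ∷ q ∷ []) z ≡ cycle3 a p q (cyc (a ∷ as) z)
  cyc-append a as p q U z = by-position (cycle3-moves U-heads-first) (z ∈? X ++ p ∷ q ∷ [])
    where
    X : List A
    X = a ∷ as
    g : A → A
    g = cycle3 a p q
    heads-first : X ++ p ∷ q ∷ [] ↭ (a ∷ p ∷ q ∷ []) ++ as ++ []
    heads-first = ↭-prep a (↭-trans (shift p as (q ∷ [])) (↭-prep p (shift q as [])))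
    U-heads-first : Unique ((a ∷ p ∷ q ∷ []) ++ as ++ [])
    U-heads-first = Unique-resp-↭ heads-first U
    heads⊆L : z ∈ a ∷ p ∷ q ∷ [] → z ∈ X ++ p ∷ q ∷ []
    heads⊆L = ∈-resp-↭ (↭-sym heads-first) ∘ ∈-++⁺ˡ
    fix-as : All (λ c → g c ≡ c) as
    fix-as = Allₚ.++⁻ˡ as (fixes-tails g (a ∷ p ∷ q ∷ []) U-heads-first cycle3-fixes)
    p≢q : p ≢ q
    p≢q with U-heads-first
    ... | _ ∷ (p≢q ∷ _) ∷ _ = p≢q

    by-position : g a ≡ p × g p ≡ q × g q ≡ a → Dec (z ∈ X ++ p ∷ q ∷ []) →
                  cyc (X ++ p ∷ q ∷ []) z ≡ g (cyc X z)
    by-position _ (no z∉L) =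
      trans (cyc-∉ z∉L) (sym (trans (cong g (cyc-∉ (z∉L ∘ ∈-++⁺ˡ))) (cycle3-fixes (z∉L ∘ heads⊆L))))
    by-position (g-a , g-p , g-q) (yes z∈L) with ∈-++⁻ X z∈L
    ... | inj₁ z∈X = relabel-block g fix-as g-a z∈X refl (cyc-block [] U refl z∈X)
    ... | inj₂ (here refl) = begin
      cyc (X ++ p ∷ q ∷ []) p ≡⟨ cyc-next X U ⟩
      q                       ≡⟨ g-p ⟨
      g p                     ≡⟨ cong g (cyc-∉ (λ p∈X → Unique-++-disjoint X U p∈X (here refl))) ⟨
      g (cyc X p)             ∎
      where open ≡-Reasoning
    ... | inj₂ (there (here refl)) = begin
      cyc (X ++ p ∷ q ∷ []) q ≡⟨ cyc-block-last X U refl (there (here refl)) ⟩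
      next a (p ∷ q ∷ []) q   ≡⟨ next-++ʳ (p ∷ []) (λ { (here q≡p) → p≢q (sym q≡p) }) ⟩
      next a (q ∷ []) q       ≡⟨ next-here q [] ⟩
      a                       ≡⟨ g-q ⟨
      g q                     ≡⟨ cong g (cyc-∉ (λ q∈X → Unique-++-disjoint X U q∈X (there (here refl)))) ⟨
      g (cyc X q)             ∎
      where open ≡-Reasoning

  -- of the two 3-cycles on a, u and w, the one following their cyclic order keeps a single cycle
  cyc-insert-after-head : ∀ a Q {u w} → Unique (a ∷ Q) → u ∈ Q → w ∈ Q → u ≢ w →
    ∃[ p ] ∃[ q ] ∃[ L′ ] (p ∷ q ∷ [] ↭ u ∷ w ∷ [] × L′ ↭ a ∷ Q ×
                           ∀ z → cyc L′ z ≡ cycle3 a p q (cyc (a ∷ Q) z))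
  cyc-insert-after-head a Q {u} {w} U u∈Q w∈Q u≢w with ∈-∃++ u∈Q
  ... | B₁ , C₁ , refl with ∈-++⁻ B₁ w∈Q
  ...   | inj₂ (here w≡u) = ⊥-elim (u≢w (sym w≡u))
  ...   | inj₂ (there w∈C₁) with ∈-∃++ w∈C₁
  ...     | B₂ , C₂ , refl =
    u , w , (a ∷ B₁) ++ (w ∷ C₂) ++ (u ∷ B₂) , ↭-refl ,
    ++⁺ˡ (a ∷ B₁) (++-comm (w ∷ C₂) (u ∷ B₂)) , cyc-exchange a B₁ u B₂ w C₂ U
  cyc-insert-after-head a Q {u} {w} U u∈Q w∈Q u≢w | B₁ , C₁ , refl | inj₁ w∈B₁ with ∈-∃++ w∈B₁
  ...     | B₂ , C₂ , refl =
    w , u , (a ∷ B₂) ++ (u ∷ C₁) ++ (w ∷ C₂) , ↭-swap w u ↭-refl ,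
    ↭-trans (++⁺ˡ (a ∷ B₂) (++-comm (u ∷ C₁) (w ∷ C₂))) (↭-reflexive (sym blocks)) ,
    λ z → trans (cyc-exchange a B₂ w C₂ u C₁ (subst Unique blocks U) z)
                (cong (λ l → cycle3 a w u (cyc l z)) (sym blocks))
    where
    blocks : a ∷ (B₂ ++ w ∷ C₂) ++ u ∷ C₁ ≡ (a ∷ B₂) ++ (w ∷ C₂) ++ (u ∷ C₁)
    blocks = cong (a ∷_) (++-assoc B₂ (w ∷ C₂) (u ∷ C₁))

  cyc-insert : ∀ {L a u w} → Unique L → a ∈ L → u ∈ L → w ∈ L → a ≢ u → a ≢ w → u ≢ w →
    ∃[ p ] ∃[ q ] ∃[ L′ ] (p ∷ q ∷ [] ↭ u ∷ w ∷ [] × L′ ↭ L ×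
                           ∀ z → cyc L′ z ≡ cycle3 a p q (cyc L z))
  cyc-insert {a = a} U a∈L u∈L w∈L a≢u a≢w u≢w with ∈-∃++ a∈L
  ... | us , vs , refl =
    let p , q , L′ , pq↭uw , L′↭ , L′-cyc = cyc-insert-after-head a (vs ++ us) (Unique-resp-↭ rotation U)
                                              (after-head u∈L a≢u) (after-head w∈L a≢w) u≢w in
    p , q , L′ , pq↭uw , ↭-trans L′↭ (↭-sym rotation) ,
    λ z → trans (L′-cyc z) (cong (cycle3 a p q) (sym (cyc-rotate us (a ∷ vs) U z)))
    where
    rotation : us ++ a ∷ vs ↭ a ∷ vs ++ us
    rotation = ++-comm us (a ∷ vs)
    after-head : ∀ {c} → c ∈ us ++ a ∷ vs → a ≢ c → c ∈ vs ++ us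
    after-head c∈L a≢c = Any.tail (a≢c ∘ sym) (∈-resp-↭ rotation c∈L)

module Settling {A V : Set} (_≟_ : DecidableEquality A) (_≟ⱽ_ : DecidableEquality V)
                (hd : A → V) (nxt : A → A) where

  open CyclicOrder _≟_

  Fibre : V → List A → Set
  Fibre v xs = Unique xs × (∀ {z} → z ∈ xs → hd z ≡ v) × (∀ {z} → hd z ≡ v → z ∈ xs)

  Fibre-resp-↭ : ∀ {v xs ys} → xs ↭ ys → Fibre v xs → Fibre v ys
  Fibre-resp-↭ xs↭ys (U , in-fibre , fibre-in) =
    Unique-resp-↭ xs↭ys U , in-fibre ∘ ∈-resp-↭ (↭-sym xs↭ys) , ∈-resp-↭ xs↭ys ∘ fibre-in

  Spanning : List A → Set
  Spanning L = Unique L × (∀ z → z ∈ L)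

  Agrees : List A → V → List A → Set
  Agrees L v M = ∀ b → hd b ≡ v → cyc L (nxt b) ≡ cyc M b

  -- the in-arcs a ∷ M at v already form one cycle of cyc L ∘ nxt; the in-arcs R are still to be inserted
  Stage : List A → V → List A → Set
  Stage L v R = ∃[ a ] ∃[ M ] (Fibre v (a ∷ M ++ R) × Agrees L v (a ∷ M))

  Staged : List A → V → Set
  Staged L v = ∃[ R ] (length R % 2 ≡ 0 × Stage L v R)

  Keeps : V → List A → List A → Set
  Keeps v L L′ =
    ∀ {v′ M} → v′ ≢ v → (∀ {c} → c ∈ M → hd c ≡ v′) → Agrees L v′ M → Agrees L′ v′ M

  Stage-kept : ∀ {v L L′} → Keeps v L L′ → ∀ {v′ R} → v′ ≢ v → Stage L v′ R → Stage L′ v′ R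
  Stage-kept keeps v′≢v (a , M , F@(_ , in-fibre , _) , agrees) =
    a , M , F , keeps v′≢v (in-fibre ∘ ∈-++⁺ˡ {xs = a ∷ M}) agrees

  Stage-settled : ∀ {L v} → Stage L v [] → ∃[ M ] (Fibre v M × Agrees L v M)
  Stage-settled {v = v} (a , M , F , agrees) = a ∷ M , subst (Fibre v) (cong (a ∷_) (++-identityʳ M)) F , agrees

  cycle3-keeps : ∀ {v L L′ a p q} → (∀ z → cyc L′ z ≡ cycle3 a p q (cyc L z)) →
                 (∀ {c} → c ∈ a ∷ p ∷ q ∷ [] → hd c ≡ v) → Keeps v L L′
  cycle3-keeps {L = L} {L′} {a} {p} {q} L′-cyc moved-in-fibre {v′} {M} v′≢v M-in-fibre agrees b hd-b = begin
    cyc L′ (nxt b)                ≡⟨ L′-cyc (nxt b) ⟩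
    cycle3 a p q (cyc L (nxt b))  ≡⟨ cong (cycle3 a p q) (agrees b hd-b) ⟩
    cycle3 a p q (cyc M b)        ≡⟨ cycle3-fixes (λ c∈ → v′≢v (trans (sym hd-c) (moved-in-fibre c∈))) ⟩
    cyc M b                       ∎
    where
    open ≡-Reasoning
    hd-c : hd (cyc M b) ≡ v′
    hd-c = cyc-preserves (λ c → hd c ≡ v′) (All.tabulate M-in-fibre) hd-b

  insert-step : ∀ {L v u w R} → Spanning L → Stage L v (u ∷ w ∷ R) →
                ∃[ L′ ] (Spanning L′ × Stage L′ v R × Keeps v L L′)
  insert-step {L} {v} {u} {w} {R} (UL , all∈L) (a , M , F@(UF , _ , _) , agrees)
    with cyc-insert UL (all∈L a) (all∈L u) (all∈L w) (∉⇒≢ a∉ (∈-++⁺ʳ M (here refl)))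
                    (∉⇒≢ a∉ (∈-++⁺ʳ M (there (here refl)))) u≢w
    where
    a∉ : a ∉ M ++ u ∷ w ∷ R
    a∉ = Unique[x∷xs]⇒x∉xs UF
    u≢w : u ≢ w
    u≢w with Unique-++⁻ʳ (a ∷ M) UF
    ... | (u≢w ∷ _) ∷ _ = u≢w
  ... | p , q , L′ , pq↭uw , L′↭L , L′-cyc =
    L′ , (Unique-resp-↭ (↭-sym L′↭L) UL , ∈-resp-↭ (↭-sym L′↭L) ∘ all∈L) ,
    (a , M ++ p ∷ q ∷ [] , F′ , agrees′) , cycle3-keeps {L = L} {L′} L′-cyc moved-in-fibre
    where
    M′ : List A
    M′ = a ∷ M ++ p ∷ q ∷ []
    F′ : Fibre v (M′ ++ R)
    F′ = Fibre-resp-↭ (↭-sym (↭-trans (↭-reflexive (cong (a ∷_) (++-assoc M (p ∷ q ∷ []) R)))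
                                      (↭-prep a (++⁺ˡ M (++⁺ʳ R pq↭uw))))) F
    agrees′ : Agrees L′ v M′
    agrees′ b hd-b = begin
      cyc L′ (nxt b)                ≡⟨ L′-cyc (nxt b) ⟩
      cycle3 a p q (cyc L (nxt b))  ≡⟨ cong (cycle3 a p q) (agrees b hd-b) ⟩
      cycle3 a p q (cyc (a ∷ M) b)  ≡⟨ cyc-append a M p q (Unique-++⁻ˡ M′ (proj₁ F′)) b ⟨
      cyc M′ b                      ∎
      where open ≡-Reasoning
    moved-in-fibre : ∀ {c} → c ∈ a ∷ p ∷ q ∷ [] → hd c ≡ v
    moved-in-fibre (here refl)                 = proj₁ (proj₂ F′) (here refl)
    moved-in-fibre (there (here refl))         = proj₁ (proj₂ F′) (there (∈-++⁺ˡ (∈-++⁺ʳ M (here refl))))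
    moved-in-fibre (there (there (here refl))) =
      proj₁ (proj₂ F′) (there (∈-++⁺ˡ (∈-++⁺ʳ M (there (here refl)))))

  settle-vertex : ∀ {L v} R → length R % 2 ≡ 0 → Spanning L → Stage L v R →
                  ∃[ L′ ] (Spanning L′ × Stage L′ v [] × Keeps v L L′)
  settle-vertex {L} []          _    spanning stage = L , spanning , stage , λ _ _ agrees → agrees
  settle-vertex     (u ∷ w ∷ R) even spanning stage with insert-step spanning stage
  ... | L₁ , spanning₁ , stage₁ , keeps₁ with settle-vertex R even spanning₁ stage₁
  ...   | L₂ , spanning₂ , stage₂ , keeps₂ =
    L₂ , spanning₂ , stage₂ ,
    λ v′≢v M-in-fibre → keeps₂ v′≢v M-in-fibre ∘ keeps₁ v′≢v M-in-fibre

  settle-all : ∀ Vs {L} → Spanning L → (∀ v → Staged L v) →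
               ∃[ L′ ] (Spanning L′ × (∀ v → Staged L′ v) × (∀ {v} → v ∈ Vs → Stage L′ v []))
  settle-all []       {L} spanning staged = L , spanning , staged , λ ()
  settle-all (v ∷ Vs) spanning staged with settle-all Vs spanning staged
  ... | L₁ , spanning₁ , staged₁ , settled₁ with staged₁ v
  ...   | R , even , stage with settle-vertex R even spanning₁ stage
  ...     | L₂ , spanning₂ , settled , keeps = L₂ , spanning₂ , staged₂ , settled₂
    where
    staged₂ : ∀ v′ → Staged L₂ v′
    staged₂ v′ with v′ ≟ⱽ v
    ... | yes refl = [] , refl , settled
    ... | no v′≢v  = let R′ , even′ , stage′ = staged₁ v′ in
                     R′ , even′ , Stage-kept {L = L₁} {L₂} keeps v′≢v stage′
    settled₂ : ∀ {v′} → v′ ∈ v ∷ Vs → Stage L₂ v′ []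
    settled₂ (here refl) = settled
    settled₂ {v′} (there v′∈Vs) with v′ ≟ⱽ v
    ... | yes refl = settled
    ... | no v′≢v  = Stage-kept {L = L₁} {L₂} keeps v′≢v (settled₁ v′∈Vs)

module CircuitOrbit {n : ℕ} (nxt : Fin n → Fin n) (single : ∀ a b → ∃[ k ] iter nxt k a ≡ b) (a₀ : Fin n)
  where

  orbit : ℕ → Fin n
  orbit t = iter nxt t a₀

  orbit-shift : ∀ {s t} → orbit s ≡ orbit t → ∀ m → orbit (m + s) ≡ orbit (m + t)
  orbit-shift {s} {t} eq m = trans (iter-+ nxt m s a₀) (trans (cong (iter nxt m) eq) (sym (iter-+ nxt m t a₀)))

  module _ {s p} (returns : orbit s ≡ orbit (suc p + s)) where

    orbit-periodic : ∀ q → orbit (q * suc p + s) ≡ orbit s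
    orbit-periodic zero    = refl
    orbit-periodic (suc q) = begin
      orbit ((suc p + q * suc p) + s) ≡⟨ cong (λ t → orbit (t + s)) (+-comm (suc p) (q * suc p)) ⟩
      orbit ((q * suc p + suc p) + s) ≡⟨ cong orbit (+-assoc (q * suc p) (suc p) s) ⟩
      orbit (q * suc p + (suc p + s)) ≡⟨ orbit-shift (sym returns) (q * suc p) ⟩
      orbit (q * suc p + s)           ≡⟨ orbit-periodic q ⟩
      orbit s                         ∎
      where open ≡-Reasoning

    orbit-covers : ∀ b → ∃[ r ] (r < suc p × orbit (r + s) ≡ b)
    orbit-covers b = let k , reaches = single (orbit s) b in k % suc p , m%n<n k (suc p) , (begin
      orbit (k % suc p + s)                       ≡⟨ orbit-shift (orbit-periodic (k / suc p)) (k % suc p) ⟨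
      orbit (k % suc p + (k / suc p * suc p + s)) ≡⟨ cong orbit (+-assoc (k % suc p) _ s) ⟨
      orbit ((k % suc p + k / suc p * suc p) + s) ≡⟨ cong (λ t → orbit (t + s)) (m≡m%n+[m/n]*n k (suc p)) ⟨
      orbit (k + s)                               ≡⟨ iter-+ nxt k s a₀ ⟩
      iter nxt k (orbit s)                        ≡⟨ reaches ⟩
      b                                           ∎)
      where open ≡-Reasoning

    -- the suc p steps after a return visit every arc, so there are at least n of them
    orbit-return-time : n ≤ suc p
    orbit-return-time = injective⇒≤ {f = λ b → fromℕ< (proj₁ (proj₂ (orbit-covers b)))} λ {b} {b′} eq →
      let r , _ , r-hits = orbit-covers b ; r′ , _ , r′-hits = orbit-covers b′ in
      trans (sym r-hits) (trans (cong (λ t → orbit (t + s)) (fromℕ<-injective r r′ _ _ eq)) r′-hits)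

  first-return : ∀ {s t} → s < t → t ≤ n → orbit s ≡ orbit t → s ≡ 0 × t ≡ n
  first-return {s} {t} s<t t≤n eq with m≤n⇒∃[o]m+o≡n s<t
  ... | p , refl = n≤0⇒n≡0 (+-cancelʳ-≤ p s 0 (s≤s⁻¹ (≤-trans t≤n n≤1+p))) ,
                   ≤-antisym t≤n (≤-trans n≤1+p (s≤s (m≤n+m p s)))
    where
    n≤1+p : n ≤ suc p
    n≤1+p = orbit-return-time (trans eq (cong (orbit ∘ suc) (+-comm s p)))

  no-early-return : ∀ {s t} → s < t → t < n → orbit s ≢ orbit t
  no-early-return s<t t<n eq = <-irrefl (proj₂ (first-return s<t (<⇒≤ t<n) eq)) t<n

  orbit-closes : orbit n ≡ orbit 0
  orbit-closes with pigeonhole ≤-refl (λ (i : Fin (suc n)) → orbit (toℕ i))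
  ... | i , j , i<j , eq =
    let i≡0 , j≡n = first-return i<j (s≤s⁻¹ (toℕ<n j)) eq in
    subst₂ (λ s t → orbit t ≡ orbit s) i≡0 j≡n (sym eq)

  orbit-surjective : ∀ b → ∃[ r ] (r < n × orbit r ≡ b)
  orbit-surjective b =
    let r , r<n , hits = orbit-covers returns b in
    r , subst (r <_) (Fin⇒suc-pred a₀) r<n , trans (cong orbit (sym (+-identityʳ r))) hits
    where
    returns : orbit 0 ≡ orbit (suc (pred n) + 0)
    returns = trans (sym orbit-closes) (cong orbit (sym (trans (+-identityʳ _) (Fin⇒suc-pred a₀))))

  nxt-period : ∀ b → iter nxt n b ≡ b
  nxt-period b with orbit-surjective b
  ... | r , _ , refl = begin
    iter nxt n (orbit r) ≡⟨ iter-+ nxt n r a₀ ⟨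
    orbit (n + r)        ≡⟨ cong orbit (+-comm n r) ⟩
    orbit (r + n)        ≡⟨ orbit-shift orbit-closes r ⟩
    orbit (r + 0)        ≡⟨ cong orbit (+-identityʳ r) ⟩
    orbit r              ∎
    where open ≡-Reasoning

  open CyclicOrder (_≟_ {n})

  -- the circuit listed backwards, so that cyc circuit undoes nxt
  circuit : List (Fin n)
  circuit = applyDownFrom orbit n

  circuit-spanning : Unique circuit × (∀ b → b ∈ circuit)
  circuit-spanning =
    applyDownFrom⁺₁ orbit n (λ j<i i<n eq → no-early-return j<i i<n (sym eq)) ,
    λ b → let r , r<n , hits = orbit-surjective b in subst (_∈ circuit) hits (∈-applyDownFrom⁺ orbit r<n)

  cyc-circuit-nxt : ∀ b → cyc circuit (nxt b) ≡ b
  cyc-circuit-nxt b with orbit-surjective b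
  ... | r , r<n , refl with <-cmp (suc r) n
  ... | tri< 1+r<n _ _ =
    let W , split = applyDownFrom-suffix orbit (≤⇒≤′ 1+r<n) in
    trans (cong (λ l → cyc l (orbit (suc r))) split) (cyc-next W (subst Unique split (proj₁ circuit-spanning)))
  ... | tri≈ _ 1+r≡n _ = begin
    cyc circuit (orbit (suc r))   ≡⟨ cong₂ cyc circuit-split (trans (cong orbit 1+r≡n) orbit-closes) ⟩
    cyc (rest ∷ʳ orbit 0) (orbit 0) ≡⟨ cyc-last rest (subst Unique circuit-split (proj₁ circuit-spanning)) ⟩
    headOr (orbit 0) rest         ≡⟨ first-arc r ⟩
    orbit r                       ∎
    where
    open ≡-Reasoning
    rest : List (Fin n)
    rest = applyDownFrom (orbit ∘ suc) r
    circuit-split : circuit ≡ rest ∷ʳ orbit 0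
    circuit-split = trans (cong (applyDownFrom orbit) (sym 1+r≡n)) (sym (applyDownFrom-∷ʳ orbit r))
    first-arc : ∀ r → headOr (orbit 0) (applyDownFrom (orbit ∘ suc) r) ≡ orbit r
    first-arc zero    = refl
    first-arc (suc _) = refl
  ... | tri> _ _ n<1+r = ⊥-elim (<-irrefl refl (<-≤-trans n<1+r r<n))

  circuit-blocks : ∀ {i j k l} → i < j → j < k → k < l → l < n → ∃[ W ] ∃[ P ] ∃[ Q ] ∃[ R ]
    circuit ≡ W ++ (orbit l ∷ P) ++ (orbit k ∷ Q) ++ (orbit j ∷ R) ++ (orbit i ∷ applyDownFrom orbit i)
  circuit-blocks i<j j<k k<l l<n =
    let W , W-split = applyDownFrom-suffix orbit (≤⇒≤′ l<n)
        P , P-split = applyDownFrom-suffix orbit (≤⇒≤′ k<l)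
        Q , Q-split = applyDownFrom-suffix orbit (≤⇒≤′ j<k)
        R , R-split = applyDownFrom-suffix orbit (≤⇒≤′ i<j) in
    W , P , Q , R ,
    trans W-split (cong (λ t → W ++ _ ∷ t) (trans P-split (cong (λ t → P ++ _ ∷ t)
      (trans Q-split (cong (λ t → Q ++ _ ∷ t) R-split)))))

  -- it is the interlacing that keeps cyc circuit a single cycle after the two transpositions
  interlaced-cycle : ∀ {i j k l} → i < j → j < k → k < l → l < n →
    ∃[ L ] (Unique L × (∀ b → b ∈ L) ×
            ∀ b → cyc L (nxt b) ≡ diagonalSwap (orbit l) (orbit k) (orbit j) (orbit i) b)
  interlaced-cycle {i} {j} {k} {l} i<j j<k k<l l<n with circuit-blocks i<j j<k k<l l<n
  ... | W , P , Q , R , split with cyc-interlaced W (orbit l) P (orbit k) Q (orbit j) R (orbit i) (applyDownFrom orbit i)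
                                      (subst Unique split (proj₁ circuit-spanning))
  ...   | L , L↭ , L-cyc =
    L , Unique-resp-↭ circuit↭L (proj₁ circuit-spanning) ,
    (λ b → ∈-resp-↭ circuit↭L (proj₂ circuit-spanning b)) ,
    λ b → trans (L-cyc (nxt b))
                (cong (diagonalSwap _ _ _ _) (trans (cong (λ l → cyc l (nxt b)) (sym split)) (cyc-circuit-nxt b)))
    where
    circuit↭L : circuit ↭ L
    circuit↭L = ↭-sym (↭-trans L↭ (↭-reflexive (sym split)))

module EulerianDigraph (D : Digraph) (T : EulerCircuit D) (a₀ : Fin (Digraph.nA D)) where

  open Digraph D
  open EulerCircuit T
  open CircuitOrbit nxt single a₀ using (orbit; no-early-return; nxt-period; interlaced-cycle)
  open CyclicOrder (_≟_ {nA})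
  open Settling (_≟_ {nA}) (_≟_ {nV}) hd nxt public

  prev : Fin nA → Fin nA
  prev = iter nxt (pred nA)

  prev-inverse : (∀ b → nxt (prev b) ≡ b) × (∀ a → prev (nxt a) ≡ a)
  prev-inverse = periodic⇒inverse nxt (pred nA) λ b →
    trans (cong (λ k → iter nxt k b) (Fin⇒suc-pred a₀)) (nxt-period b)

  nxt-prev : ∀ b → nxt (prev b) ≡ b
  nxt-prev = proj₁ prev-inverse

  prev-nxt : ∀ a → prev (nxt a) ≡ a
  prev-nxt = proj₂ prev-inverse

  inArcs : Fin nV → List (Fin nA)
  inArcs v = filter (λ a → hd a ≟ v) (allFin nA)

  inArcs-fibre : ∀ v → Fibre v (inArcs v)
  inArcs-fibre v = filter⁺ (λ a → hd a ≟ v) (allFin⁺ nA) ,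
                   (λ a∈ → proj₂ (∈-filter⁻ (λ a → hd a ≟ v) {xs = allFin nA} a∈)) ,
                   ∈-filter⁺ (λ a → hd a ≟ v) (∈-allFin _)

  -- nxt maps the in-arcs at v bijectively onto the out-arcs at v
  deg-inArcs : ∀ v → deg D v ≡ length (inArcs v) + length (inArcs v)
  deg-inArcs v = cong (_+ length (inArcs v)) (trans (↭-length out↭in) (length-map nxt (inArcs v)))
    where
    outArcs : List (Fin nA)
    outArcs = filter (λ a → tl a ≟ v) (allFin nA)
    in-fibre : ∀ {a} → a ∈ inArcs v → hd a ≡ v
    in-fibre = proj₁ (proj₂ (inArcs-fibre v))
    fibre-in : ∀ {a} → hd a ≡ v → a ∈ inArcs v
    fibre-in = proj₂ (proj₂ (inArcs-fibre v))
    out-tl : ∀ {b} → b ∈ outArcs → tl b ≡ v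
    out-tl = proj₂ ∘ ∈-filter⁻ (λ a → tl a ≟ v) {xs = allFin nA}
    out⇒in : ∀ {b} → b ∈ outArcs → b ∈ map nxt (inArcs v)
    out⇒in {b} b∈ = subst (_∈ map nxt (inArcs v)) (nxt-prev b)
      (∈-map⁺ nxt (fibre-in (trans (consecutive (prev b)) (trans (cong tl (nxt-prev b)) (out-tl b∈)))))
    in⇒out : ∀ {b} → b ∈ map nxt (inArcs v) → b ∈ outArcs
    in⇒out b∈ with ∈-map⁻ nxt b∈
    ... | a , a∈ , refl =
      ∈-filter⁺ (λ a → tl a ≟ v) (∈-allFin (nxt a)) (trans (sym (consecutive a)) (in-fibre a∈))
    out↭in : outArcs ↭ map nxt (inArcs v)
    out↭in = ∼bag⇒↭ (unique∧set⇒bag (filter⁺ (λ a → tl a ≟ v) (allFin⁺ nA))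
                                     (map⁺ (λ eq → trans (sym (prev-nxt _)) (trans (cong prev eq) (prev-nxt _)))
                                           (proj₁ (inArcs-fibre v)))
                                     (mk⇔ out⇒in in⇒out))

  module Embedding (ρ ρ⁻¹ : Fin nA → Fin nA)
                   (ρ-ρ⁻¹ : ∀ a → ρ (ρ⁻¹ a) ≡ a) (ρ⁻¹-ρ : ∀ a → ρ⁻¹ (ρ a) ≡ a)
                   (hd-ρ : ∀ b → hd (ρ b) ≡ tl b) (ρ-reaches : ∀ a b → ∃[ k ] iter ρ k a ≡ b)
                   (local-cycle : ∀ a a′ → hd a ≡ hd a′ → ∃[ m ] iter (ρ ∘ nxt) m a ≡ a′) where

    rot : Dart D → Dart D
    rot (inj₁ b) = inj₂ (ρ b)
    rot (inj₂ a) = inj₁ (nxt a)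

    rot⁻¹ : Dart D → Dart D
    rot⁻¹ (inj₁ b) = inj₂ (prev b)
    rot⁻¹ (inj₂ a) = inj₁ (ρ⁻¹ a)

    rot-rot⁻¹ : ∀ d → rot (rot⁻¹ d) ≡ d
    rot-rot⁻¹ (inj₁ b) = cong inj₁ (nxt-prev b)
    rot-rot⁻¹ (inj₂ a) = cong inj₂ (ρ-ρ⁻¹ a)

    rot⁻¹-rot : ∀ d → rot⁻¹ (rot d) ≡ d
    rot⁻¹-rot (inj₁ b) = cong inj₁ (ρ⁻¹-ρ b)
    rot⁻¹-rot (inj₂ a) = cong inj₂ (prev-nxt a)

    rot-vert : ∀ d → dvert D (rot d) ≡ dvert D d
    rot-vert (inj₁ b) = hd-ρ b
    rot-vert (inj₂ a) = sym (consecutive a)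

    to-incoming : ∀ d → ∃[ k ] ∃[ a ] (iter rot k d ≡ inj₂ a × hd a ≡ dvert D d)
    to-incoming (inj₁ b) = 1 , ρ b , refl , hd-ρ b
    to-incoming (inj₂ a) = 0 , a , refl , refl

    from-incoming : ∀ e → ∃[ k ] ∃[ a ] (iter rot k (inj₂ a) ≡ e × hd a ≡ dvert D e)
    from-incoming (inj₁ b) = 1 , prev b , cong inj₁ (nxt-prev b) , trans (consecutive (prev b)) (cong tl (nxt-prev b))
    from-incoming (inj₂ a) = 0 , a , refl , refl

    between-incoming : ∀ a a′ → hd a ≡ hd a′ → ∃[ k ] iter rot k (inj₂ a) ≡ inj₂ a′
    between-incoming a a′ same = let m , reaches = local-cycle a a′ same in
      m + m , trans (sym (iter-twice rot m (inj₂ a)))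
                    (trans (sym (iter-commute inj₂ (λ _ → refl) m a)) (cong inj₂ reaches))

    rot-cyc : ∀ d e → dvert D d ≡ dvert D e → ∃[ k ] iter rot k d ≡ e
    rot-cyc d e same with to-incoming d | from-incoming e
    ... | k₁ , a , to-a , hd-a | k₂ , a′ , from-a′ , hd-a′
      with between-incoming a a′ (trans hd-a (trans same (sym hd-a′)))
    ...   | k , a-to-a′ = k₂ + (k + k₁) , (begin
      iter rot (k₂ + (k + k₁)) d               ≡⟨ iter-+ rot k₂ (k + k₁) d ⟩
      iter rot k₂ (iter rot (k + k₁) d)        ≡⟨ cong (iter rot k₂) (iter-+ rot k k₁ d) ⟩
      iter rot k₂ (iter rot k (iter rot k₁ d)) ≡⟨ cong (iter rot k₂ ∘ iter rot k) to-a ⟩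
      iter rot k₂ (iter rot k (inj₂ a))        ≡⟨ cong (iter rot k₂) a-to-a′ ⟩
      iter rot k₂ (inj₂ a′)                    ≡⟨ from-a′ ⟩
      e                                        ∎)
      where open ≡-Reasoning

    rotation : RotationSystem D
    rotation = record { rot = rot ; rot⁻¹ = rot⁻¹ ; rot-inv₁ = rot-rot⁻¹ ; rot-inv₂ = rot⁻¹-rot
                      ; rot-vert = rot-vert ; rot-cyc = rot-cyc }

    open RotationSystem rotation using (φ; SameFace)

    φ-forward : ∀ k a → iter φ k (inj₁ a) ≡ inj₁ (iter nxt k a)
    φ-forward k a = sym (iter-commute inj₁ (λ _ → refl) k a)

    φ-backward : ∀ k a → iter φ k (inj₂ a) ≡ inj₂ (iter ρ k a)
    φ-backward k a = sym (iter-commute inj₂ (λ _ → refl) k a)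

    forward-face : ∀ a b → SameFace (inj₁ a) (inj₁ b)
    forward-face a b = let k , reaches = single a b in k , trans (φ-forward k a) (cong inj₁ reaches)

    backward-face : ∀ a b → SameFace (inj₂ a) (inj₂ b)
    backward-face a b = let k , reaches = ρ-reaches a b in k , trans (φ-backward k a) (cong inj₂ reaches)

    directed : DirectedEmbedding D rotation
    directed (inj₁ a) = inj₁ (λ k → iter nxt k a , φ-forward k a)
    directed (inj₂ a) = inj₂ (λ k → iter ρ k a , φ-backward k a)

    face-euler : ∀ d → FaceEuler D rotation d
    face-euler (inj₁ a) = inj₁ ((λ k → iter nxt k a , φ-forward k a) , forward-face a)
    face-euler (inj₂ a) = inj₂ ((λ k → iter ρ k a , φ-backward k a) , backward-face a)

    two-faces : ExactlyTwoFaces D rotation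
    two-faces = inj₁ a₀ , inj₂ a₀ ,
                (λ { (k , φᵏ≡) → inj₁≢inj₂ (trans (sym (φ-forward k a₀)) φᵏ≡) }) ,
                λ { (inj₁ b) → inj₁ (forward-face a₀ b) ; (inj₂ b) → inj₂ (backward-face a₀ b) }
      where
      inj₁≢inj₂ : ∀ {a b : Fin nA} → inj₁ a ≢ inj₂ b
      inj₁≢inj₂ ()

    bi-eulerian : ∃[ R ] (BiEulerianDirected D R × HasFaceBoundedBy D R T)
    bi-eulerian = rotation , (directed , two-faces , face-euler) , inj₁ (λ a → refl)

  settled-embedding : ∀ {L} → Spanning L → (∀ v → ∃[ M ] (Fibre v M × Agrees L v M)) →
                      ∃[ R ] (BiEulerianDirected D R × HasFaceBoundedBy D R T)
  settled-embedding {L} (U , all∈L) cycles =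
    Embedding.bi-eulerian (cyc L) (proj₁ inverse) (proj₁ (proj₂ inverse)) (proj₂ (proj₂ inverse)) hd-ρ
      (λ a b → cyc-connected U (all∈L a) (all∈L b)) local-cycle
    where
    inverse : Σ (Fin nA → Fin nA) λ g → (∀ z → cyc L (g z) ≡ z) × (∀ z → g (cyc L z) ≡ z)
    inverse = cyc-inverse U
    hd-cycle : ∀ c → hd (cyc L (nxt c)) ≡ hd c
    hd-cycle c = let M , (_ , in-fibre , _) , agrees = cycles (hd c) in
      trans (cong hd (agrees c refl)) (cyc-preserves (λ z → hd z ≡ hd c) (All.tabulate in-fibre) refl)
    hd-ρ : ∀ b → hd (cyc L b) ≡ tl b
    hd-ρ b = begin
      hd (cyc L b)               ≡⟨ cong (hd ∘ cyc L) (nxt-prev b) ⟨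
      hd (cyc L (nxt (prev b)))  ≡⟨ hd-cycle (prev b) ⟩
      hd (prev b)                ≡⟨ consecutive (prev b) ⟩
      tl (nxt (prev b))          ≡⟨ cong tl (nxt-prev b) ⟩
      tl b                       ∎
      where open ≡-Reasoning
    local-cycle : ∀ a a′ → hd a ≡ hd a′ → ∃[ m ] iter (cyc L ∘ nxt) m a ≡ a′
    local-cycle a a′ same with cycles (hd a)
    ... | M , (UM , _ , fibre-in) , agrees with cyc-connected UM (fibre-in refl) (fibre-in (sym same))
    ...   | m , reaches = m , trans (iter-cong-on (λ c → hd c ≡ hd a) (λ hc → trans (hd-cycle _) hc)
                                                  (λ {c} hc → agrees c hc) m refl) reaches

  single-stage : ∀ {L v} → deg D v % 4 ≡ 2 → (∀ b → hd b ≡ v → cyc L (nxt b) ≡ b) → Staged L v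
  single-stage {L} {v} deg≡2 fixes with inArcs v | inArcs-fibre v | deg-inArcs v
  ... | []    | _ | deg≡ = ⊥-elim (0%4≢2 (trans (sym (cong (_% 4) deg≡)) deg≡2))
    where
    0%4≢2 : 0 % 4 ≢ 2
    0%4≢2 ()
  ... | h ∷ R | F | deg≡ = R , [1+r+1+r]%4≡2⇒r%2≡0 (length R) (trans (sym (cong (_% 4) deg≡)) deg≡2) ,
                           h , [] , F , λ b hb → trans (fixes b hb) (sym (cyc-singleton h b))

  paired-stage : ∀ {L v u w} → ¬ deg D v % 4 ≡ 2 → hd u ≡ v → hd w ≡ v → u ≢ w →
                 Agrees L v (u ∷ w ∷ []) → Staged L v
  paired-stage {L} {v} {u} {w} deg≢2 hu hw u≢w agrees
    with ∈⇒↭∷∷ (proj₂ (proj₂ (inArcs-fibre v)) hu) (proj₂ (proj₂ (inArcs-fibre v)) hw) u≢w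
  ... | R , arcs↭ = R , [2+r+2+r]%4≢2⇒r%2≡0 (length R) (deg≢2 ∘ trans (cong (_% 4) deg≡)) ,
                    u , w ∷ [] , Fibre-resp-↭ arcs↭ (inArcs-fibre v) , agrees
    where
    deg≡ : deg D v ≡ suc (suc (length R)) + suc (suc (length R))
    deg≡ = trans (deg-inArcs v) (cong (λ n → n + n) (↭-length arcs↭))

  module Interlaced {x y i j k l} (x≢y : x ≢ y) (i<j : i < j) (j<k : j < k) (k<l : k < l) (l<n : l < nA)
                    (x₁ : hd (orbit i) ≡ x) (y₁ : hd (orbit j) ≡ y)
                    (x₂ : hd (orbit k) ≡ x) (y₂ : hd (orbit l) ≡ y) where

    x≢y-arcs : ∀ {c d} → hd c ≡ x → hd d ≡ y → c ≢ d
    x≢y-arcs hc hd′ c≡d = x≢y (trans (sym hc) (trans (cong hd c≡d) hd′))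

    k≢i : orbit k ≢ orbit i
    k≢i = no-early-return (<-trans i<j j<k) (<-trans k<l l<n) ∘ sym

    l≢j : orbit l ≢ orbit j
    l≢j = no-early-return (<-trans j<k k<l) l<n ∘ sym

    module _ {L} (L-cyc : ∀ b → cyc L (nxt b) ≡ diagonalSwap (orbit l) (orbit k) (orbit j) (orbit i) b) where

      agrees-x : Agrees L x (orbit k ∷ orbit i ∷ [])
      agrees-x b hb = begin
        cyc L (nxt b)                                          ≡⟨ L-cyc b ⟩
        swap (orbit l) (orbit j) (swap (orbit k) (orbit i) b) ≡⟨ swap-≢ (x≢y-arcs hc y₂) (x≢y-arcs hc y₁) ⟩
        swap (orbit k) (orbit i) b                             ≡⟨ cyc-pair k≢i b ⟨
        cyc (orbit k ∷ orbit i ∷ []) b                         ∎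
        where
        open ≡-Reasoning
        hc : hd (swap (orbit k) (orbit i) b) ≡ x
        hc = swap-preserves (λ c → hd c ≡ x) x₂ x₁ hb

      agrees-y : Agrees L y (orbit l ∷ orbit j ∷ [])
      agrees-y b hb = begin
        cyc L (nxt b)                                          ≡⟨ L-cyc b ⟩
        swap (orbit l) (orbit j) (swap (orbit k) (orbit i) b)
          ≡⟨ cong (swap (orbit l) (orbit j)) (swap-≢ (x≢y-arcs x₂ hb ∘ sym) (x≢y-arcs x₁ hb ∘ sym)) ⟩
        swap (orbit l) (orbit j) b                             ≡⟨ cyc-pair l≢j b ⟨
        cyc (orbit l ∷ orbit j ∷ []) b                         ∎
        where open ≡-Reasoning

      fixed-elsewhere : ∀ {v} → v ≢ x → v ≢ y → ∀ b → hd b ≡ v → cyc L (nxt b) ≡ b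
      fixed-elsewhere v≢x v≢y b hb = trans (L-cyc b) (diagonalSwap-fixes λ
        { (here eq)                         → v≢y (trans (sym hb) (trans (cong hd eq) y₂))
        ; (there (here eq))                 → v≢x (trans (sym hb) (trans (cong hd eq) x₂))
        ; (there (there (here eq)))         → v≢y (trans (sym hb) (trans (cong hd eq) y₁))
        ; (there (there (there (here eq)))) → v≢x (trans (sym hb) (trans (cong hd eq) x₁)) })

    interlaced-stages : (∀ v → v ≢ x → v ≢ y → deg D v % 4 ≡ 2) →
                        ¬ deg D x % 4 ≡ 2 → ¬ deg D y % 4 ≡ 2 → ∃[ L ] (Spanning L × ∀ v → Staged L v)
    interlaced-stages deg-v deg-x deg-y with interlaced-cycle i<j j<k k<l l<n
    ... | L , U , all∈L , L-cyc = L , (U , all∈L) , staged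
      where
      staged : ∀ v → Staged L v
      staged v with v ≟ x | v ≟ y
      ... | yes refl | _        = paired-stage {L = L} deg-x x₂ x₁ k≢i (agrees-x {L} L-cyc)
      ... | no _     | yes refl = paired-stage {L = L} deg-y y₂ y₁ l≢j (agrees-y {L} L-cyc)
      ... | no v≢x   | no v≢y   = single-stage {L = L} (deg-v v v≢x v≢y) (fixed-elsewhere {L} L-cyc v≢x v≢y)

theorem4p8 : (D : Digraph) (x y : Fin (Digraph.nV D)) → x ≢ y →
    (∀ v → v ≢ x → v ≢ y → deg D v % 4 ≡ 2) →
    ¬ (deg D x % 4 ≡ 2) → ¬ (deg D y % 4 ≡ 2) →
    (T : EulerCircuit D) → Interlaces D T x y →
    ∃[ R ] (BiEulerianDirected D R × HasFaceBoundedBy D R T)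
theorem4p8 D x y x≢y deg-v deg-x deg-y T (a₀ , i , j , k , l , i<j , j<k , k<l , l<n , x₁ , y₁ , x₂ , y₂) =
  let _ , spanning₀ , staged₀ =
        Interlaced.interlaced-stages x≢y i<j j<k k<l l<n x₁ y₁ x₂ y₂ deg-v deg-x deg-y
      L , spanning , _ , settled = settle-all (allFin (Digraph.nV D)) spanning₀ staged₀
  in settled-embedding {L = L} spanning (λ v → Stage-settled {L = L} (settled (∈-allFin v)))
  where open EulerianDigraph D T a₀
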